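{- Let $G$ and $H$ be finite simple graphs such that $G\in\mathfrak{F}$ and $H$ is a Roman graph. Then $\gamma_R(G\Box H)\ge 2\gamma(G)\gamma(H)$.
   Context: $\gamma(X)$ denotes the domination number of a graph $X$ (minimum size of a set $D$ such that every vertex outside $D$ has a neighbor in $D$). A Roman dominating function on $X$ is a map $f:V(X)\to\{0,1,2\}$ such that every vertex $v$ with $f(v)=0$ has a neighbor $u$ with $f(u)=2$; $\gamma_R(X)$ is the minimum of $\sum_v f(v)$ over such $f$. A graph $H$ is Roman if $\gamma_R(H)=2\gamma(H)$. $\mathfrak{F}$ is the class of graphs $G$ having a dominating set $S=\{u_1,\dots,u_{\gamma(G)}\}$ of size $\gamma(G)$ with $N[u_i]\cap N[u_j]=\emptyset$ for all $i\ne j$, where $N[u]$ is the closed neighborhood of $u$. The Cartesian product $G\Box H$ has vertex set $V(G)\times V(H)$, with $(g,h)\sim(g',h')$ iff ($g=g'$ and $h\sim h'$) or ($g\sim g'$ and $h=h'$). -}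

module Defs where

open import Level using (0ℓ)
open import Data.Nat using (ℕ; _+_; _*_; _≤_)
open import Data.Fin using (Fin; remQuot)
open import Data.Fin.Subset using (Subset; _∈_; ∣_∣)
open import Data.List using (map; allFin)
open import Data.Nat.ListAction using (sum)
open import Data.Product using (Σ; _×_; _,_; proj₁; proj₂; ∃)
open import Data.Sum using (_⊎_)
open import Data.Empty using (⊥)
open import Relation.Nullary using (¬_)
open import Relation.Binary.PropositionalEquality using (_≡_)

record Graph : Set₁ where
  field
    n     : ℕ
    Adj   : Fin n → Fin n → Set
    sym   : ∀ {u v} → Adj u v → Adj v u
    irrefl : ∀ {u} → ¬ Adj u u
open Graph public

InClosedNbhd : (X : Graph) → Fin (n X) → Fin (n X) → Set
InClosedNbhd X u w = (w ≡ u) ⊎ Adj X u w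

IsDominating : (X : Graph) → Subset (n X) → Set
IsDominating X D = ∀ v → ¬ (v ∈ D) → ∃ λ u → u ∈ D × Adj X v u

IsDominationNumber : (X : Graph) → ℕ → Set
IsDominationNumber X k =
  (Σ (Subset (n X)) λ D → IsDominating X D × ∣ D ∣ ≡ k)
  × (∀ D → IsDominating X D → k ≤ ∣ D ∣)

open import Data.Fin using (toℕ)

IsRDF : (X : Graph) → (Fin (n X) → Fin 3) → Set
IsRDF X f = ∀ v → toℕ (f v) ≡ 0 → ∃ λ u → Adj X v u × toℕ (f u) ≡ 2

weight : (X : Graph) → (Fin (n X) → Fin 3) → ℕ
weight X f = sum (map (λ v → toℕ (f v)) (allFin (n X)))

IsRomanDominationNumber : (X : Graph) → ℕ → Set
IsRomanDominationNumber X k =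
  (Σ (Fin (n X) → Fin 3) λ f → IsRDF X f × weight X f ≡ k)
  × (∀ f → IsRDF X f → k ≤ weight X f)

IsRomanGraph : Graph → Set
IsRomanGraph H = ∀ k → IsDominationNumber H k → IsRomanDominationNumber H (2 * k)

InClassF : Graph → Set
InClassF G = Σ (Subset (n G)) λ S →
  IsDominating G S
  × (∀ D → IsDominating G D → ∣ S ∣ ≤ ∣ D ∣)
  × (∀ u v → u ∈ S → v ∈ S → ¬ (u ≡ v) →
       ∀ w → InClosedNbhd G u w → InClosedNbhd G v w → ⊥)

-- Cartesian product G □ H on Fin (n G * n H), vertex i ↔ remQuot i = (g , h)
□-Adj : (G H : Graph) → Fin (n G * n H) → Fin (n G * n H) → Set
□-Adj G H x y =
  (proj₁ (remQuot {n G} (n H) x) ≡ proj₁ (remQuot {n G} (n H) y)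
     × Adj H (proj₂ (remQuot {n G} (n H) x)) (proj₂ (remQuot {n G} (n H) y)))
  ⊎ (Adj G (proj₁ (remQuot {n G} (n H) x)) (proj₁ (remQuot {n G} (n H) y))
     × proj₂ (remQuot {n G} (n H) x) ≡ proj₂ (remQuot {n G} (n H) y))

_□_ : Graph → Graph → Graph
G □ H = record
  { n = n G * n H
  ; Adj = □-Adj G H
  ; sym = λ { (_⊎_.inj₁ (e , a)) → _⊎_.inj₁ (Eq.sym e , Graph.sym H a)
            ; (_⊎_.inj₂ (a , e)) → _⊎_.inj₂ (Graph.sym G a , Eq.sym e) }
  ; irrefl = λ { (_⊎_.inj₁ (_ , a)) → Graph.irrefl H a
               ; (_⊎_.inj₂ (a , _)) → Graph.irrefl G a }
  }
  where import Relation.Binary.PropositionalEquality as Eq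

-- Let f be a Roman dominating function of G □ H and S a minimum dominating set of G with
-- pairwise disjoint closed neighbourhoods. For u ∈ S and h ∈ V(H) pick a vertex c(u,h) ∈ N[u]:
-- u itself, unless f(u,h) = 0 and (u,h) is defended from a G-neighbour g, in which case g.
-- Then h ↦ f(c(u,h),h) is a Roman dominating function of H, of weight ≥ γ_R(H) = 2γ(H).
-- Disjointness of the neighbourhoods makes (c(u,h),h) distinct for distinct u ∈ S, so
-- weight f ≥ |S| · 2γ(H) = 2γ(G)γ(H).
module Submission where

open import Defs hiding (sym)
open import Algebra.Bundles using (Monoid)
open import Data.Bool using (true; false; if_then_else_)
open import Data.Empty using (⊥)
open import Data.Fin using (Fin; zero; suc; toℕ; combine; _↑ˡ_; _↑ʳ_)
open import Data.Fin.Properties using (toℕ<n; remQuot-combine; combine-remQuot)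
  renaming (_≟_ to _≟ᶠ_; suc-injective to Fin-suc-injective)
open import Data.Fin.Subset using (Subset; _∈_; ∣_∣)
open import Data.List using (map; tabulate)
import Data.Nat.ListAction as List
open import Data.Nat using (ℕ; zero; suc; _+_; _*_; _≤_; _<_; z≤n; s≤s⁻¹; _≟_)
open import Data.Nat.Properties
  using (≤-refl; ≤-antisym; <-≤-trans; +-mono-≤; +-identityʳ; *-comm; *-assoc;
         *-monoˡ-≤; n≢0⇒n>0; +-0-monoid; +-0-commutativeMonoid; module ≤-Reasoning)
open import Data.Product using (_×_; _,_; ∃; proj₂)
open import Data.Sum using (_⊎_; inj₁; inj₂)
open import Data.Vec using ([]; _∷_; lookup)
open import Data.Vec.Functional using (Vector)
open import Data.Vec.Properties using (lookup⇒[]=)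
open import Function using (_∘_; const)
open import Relation.Nullary using (¬_; yes; no; contradiction)
open import Relation.Binary.PropositionalEquality using (_≡_; refl; sym; trans; cong; subst; subst₂)

module _ {a ℓ} (M : Monoid a ℓ) where
  open Monoid M using (Carrier; _≈_; _∙_; ε; assoc; identityˡ; ∙-congˡ; setoid)
  open import Algebra.Properties.Monoid.Sum M using (sum-syntax)
  open import Relation.Binary.Reasoning.Setoid setoid

  ∑-↑ : ∀ m n (t : Vector Carrier (m + n)) →
    ∑[ i < m + n ] t i ≈ ∑[ i < m ] t (i ↑ˡ n) ∙ ∑[ j < n ] t (m ↑ʳ j)
  ∑-↑ zero n t = begin
    ∑[ j < n ] t j      ≈⟨ identityˡ _ ⟨
    ε ∙ ∑[ j < n ] t j  ∎
  ∑-↑ (suc m) n t = begin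
    t zero ∙ ∑[ i < m + n ] t (suc i)                          ≈⟨ ∙-congˡ (∑-↑ m n (t ∘ suc)) ⟩
    t zero ∙ (∑[ i < m ] t (suc i ↑ˡ n) ∙ ∑[ j < n ] t (suc m ↑ʳ j)) ≈⟨ assoc _ _ _ ⟨
    (t zero ∙ ∑[ i < m ] t (suc i ↑ˡ n)) ∙ ∑[ j < n ] t (suc m ↑ʳ j) ∎

  ∑-combine : ∀ m n (t : Vector Carrier (m * n)) →
    ∑[ k < m * n ] t k ≈ ∑[ i < m ] ∑[ j < n ] t (combine i j)
  ∑-combine zero n t = begin ε ∎
  ∑-combine (suc m) n t = begin
    ∑[ k < n + m * n ] t k                                          ≈⟨ ∑-↑ n (m * n) t ⟩
    ∑[ j < n ] t (j ↑ˡ m * n) ∙ ∑[ k < m * n ] t (n ↑ʳ k)           ≈⟨ ∙-congˡ (∑-combine m n (t ∘ (n ↑ʳ_))) ⟩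
    ∑[ j < n ] t (j ↑ˡ m * n) ∙ ∑[ i < m ] ∑[ j < n ] t (n ↑ʳ combine i j)  ∎

open import Algebra.Properties.CommutativeMonoid.Sum +-0-commutativeMonoid
  using (sum-syntax; ∑-comm; sum-cong-≗; sum-replicate-zero) renaming (sum to ∑)

sum-map-tabulate : ∀ {a} {A : Set a} {n} (g : Fin n → A) (t : A → ℕ) →
  List.sum (map t (tabulate g)) ≡ ∑[ i < n ] t (g i)
sum-map-tabulate {n = zero}  g t = refl
sum-map-tabulate {n = suc n} g t = cong (t (g zero) +_) (sum-map-tabulate (g ∘ suc) t)

weight≡∑ : (X : Graph) (φ : Fin (n X) → Fin 3) → weight X φ ≡ ∑[ v < n X ] toℕ (φ v)
weight≡∑ X φ = sum-map-tabulate (λ v → v) (toℕ ∘ φ)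

∑-mono-≤ : ∀ {n} {s t : Vector ℕ n} → (∀ i → s i ≤ t i) → ∑ s ≤ ∑ t
∑-mono-≤ {zero}  _   = z≤n
∑-mono-≤ {suc n} s≤t = +-mono-≤ (s≤t zero) (∑-mono-≤ (s≤t ∘ suc))

∑-≤-atMostOnePositive : ∀ {n b} (t : Vector ℕ n) → (∀ i → t i ≤ b) →
  (∀ i j → 0 < t i → 0 < t j → i ≡ j) → ∑ t ≤ b
∑-≤-atMostOnePositive {zero} t _ _ = z≤n
∑-≤-atMostOnePositive {suc n} {b} t bound unique with t zero ≟ 0
... | yes t₀≡0 = begin
  t zero + ∑ (t ∘ suc)  ≡⟨ cong (_+ ∑ (t ∘ suc)) t₀≡0 ⟩
  ∑ (t ∘ suc)           ≤⟨ ∑-≤-atMostOnePositive (t ∘ suc) (bound ∘ suc) unique-tail ⟩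
  b                     ∎
  where
  open ≤-Reasoning
  unique-tail : ∀ i j → 0 < t (suc i) → 0 < t (suc j) → i ≡ j
  unique-tail i j p q = Fin-suc-injective (unique (suc i) (suc j) p q)
... | no t₀≢0 = begin
  t zero + ∑ (t ∘ suc)  ≡⟨ cong (t zero +_) (trans (sum-cong-≗ tail-vanishes) (sum-replicate-zero n)) ⟩
  t zero + 0            ≡⟨ +-identityʳ (t zero) ⟩
  t zero                ≤⟨ bound zero ⟩
  b                     ∎
  where
  open ≤-Reasoning
  tail-vanishes : ∀ i → t (suc i) ≡ 0
  tail-vanishes i with t (suc i) ≟ 0
  ... | yes tᵢ≡0 = tᵢ≡0
  ... | no tᵢ≢0 = contradiction (unique zero (suc i) (n≢0⇒n>0 t₀≢0) (n≢0⇒n>0 tᵢ≢0)) λ ()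

infix 5 _↦_

_↦_ : ∀ {n} → Fin n → ℕ → Vector ℕ n
(zero  ↦ c) zero    = c
(zero  ↦ c) (suc _) = 0
(suc _ ↦ c) zero    = 0
(suc a ↦ c) (suc j) = (a ↦ c) j

∑-↦ : ∀ {n} (a : Fin n) c → ∑ (a ↦ c) ≡ c
∑-↦ {suc n} zero    c = trans (cong (c +_) (sum-replicate-zero n)) (+-identityʳ c)
∑-↦ {suc n} (suc a) c = ∑-↦ a c

↦-≤ : ∀ {n} (t : Vector ℕ n) a j {c} → c ≤ t a → (a ↦ c) j ≤ t j
↦-≤ t zero    zero    c≤tₐ = c≤tₐ
↦-≤ t zero    (suc j) _    = z≤n
↦-≤ t (suc a) zero    _    = z≤n
↦-≤ t (suc a) (suc j) c≤tₐ = ↦-≤ (t ∘ suc) a j c≤tₐ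

↦-support : ∀ {n} (a j : Fin n) c → 0 < (a ↦ c) j → a ≡ j
↦-support zero    zero    c _ = refl
↦-support (suc a) (suc j) c p = cong suc (↦-support a j c p)

-- Each term s i is spread over the column e i; every column then has at most one positive entry.
∑-≤-injectiveOnSupport : ∀ {m n} (s : Vector ℕ m) (t : Vector ℕ n) (e : Fin m → Fin n) →
  (∀ i → s i ≤ t (e i)) → (∀ i i′ → 0 < s i → 0 < s i′ → e i ≡ e i′ → i ≡ i′) →
  ∑ s ≤ ∑ t
∑-≤-injectiveOnSupport {m} {n} s t e s≤t injective = begin
  ∑[ i < m ] s i                       ≡⟨ sum-cong-≗ (λ i → ∑-↦ (e i) (s i)) ⟨
  ∑[ i < m ] ∑[ j < n ] (e i ↦ s i) j  ≡⟨ ∑-comm (λ i j → (e i ↦ s i) j) ⟩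
  ∑[ j < n ] ∑[ i < m ] (e i ↦ s i) j  ≤⟨ ∑-mono-≤ column≤ ⟩
  ∑[ j < n ] t j                       ∎
  where
  open ≤-Reasoning
  positive : ∀ i j → 0 < (e i ↦ s i) j → e i ≡ j × 0 < s i
  positive i j p = ↦-support (e i) j (s i) p , <-≤-trans p (↦-≤ (const (s i)) (e i) j ≤-refl)
  column≤ : ∀ j → ∑[ i < m ] (e i ↦ s i) j ≤ t j
  column≤ j = ∑-≤-atMostOnePositive (λ i → (e i ↦ s i) j) (λ i → ↦-≤ t (e i) j (s≤t i)) unique
    where
    unique : ∀ i i′ → 0 < (e i ↦ s i) j → 0 < (e i′ ↦ s i′) j → i ≡ i′
    unique i i′ p p′ with positive i j p | positive i′ j p′
    ... | eᵢ≡j , sᵢ>0 | eᵢ′≡j , sᵢ′>0 = injective i i′ sᵢ>0 sᵢ′>0 (trans eᵢ≡j (sym eᵢ′≡j))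

restrict : ∀ {n} → Subset n → Vector ℕ n → Vector ℕ n
restrict S t i = if lookup S i then t i else 0

∑-restrict-const : ∀ {n} (S : Subset n) c → ∑ (restrict S (const c)) ≡ ∣ S ∣ * c
∑-restrict-const []          c = refl
∑-restrict-const (true  ∷ S) c = cong (c +_) (∑-restrict-const S c)
∑-restrict-const (false ∷ S) c = ∑-restrict-const S c

restrict-≤ : ∀ {n} (S : Subset n) t i → restrict S t i ≤ t i
restrict-≤ S t i with lookup S i
... | true  = ≤-refl
... | false = z≤n

restrict-support : ∀ {n} (S : Subset n) t i → 0 < restrict S t i → i ∈ S
restrict-support S t i p with lookup S i in Sᵢ
... | true = lookup⇒[]= i S Sᵢ

Is2Packing : (G : Graph) → Subset (n G) → Set
Is2Packing G S = ∀ u v → u ∈ S → v ∈ S → ¬ u ≡ v →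
  ∀ w → InClosedNbhd G u w → InClosedNbhd G v w → ⊥

□-Adj-combine : ∀ (G H : Graph) {g g′ h h′} → □-Adj G H (combine g h) (combine g′ h′) →
  (g ≡ g′ × Adj H h h′) ⊎ (Adj G g g′ × h ≡ h′)
□-Adj-combine G H {g} {g′} {h} {h′} =
  subst₂ AdjInCoordinates (remQuot-combine g h) (remQuot-combine g′ h′)
  where
  AdjInCoordinates : Fin (n G) × Fin (n H) → Fin (n G) × Fin (n H) → Set
  AdjInCoordinates (g , h) (g′ , h′) = (g ≡ g′ × Adj H h h′) ⊎ (Adj G g g′ × h ≡ h′)

module Projection (G H : Graph) (f : Fin (n G * n H) → Fin 3) (f-rdf : IsRDF (G □ H) f) where

  f⟨_,_⟩ : Fin (n G) → Fin (n H) → ℕ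
  f⟨ g , h ⟩ = toℕ (f (combine g h))

  CoveredInFibres : Fin (n G) → Fin (n H) → Set
  CoveredInFibres g h =
    (∃ λ h′ → Adj H h h′ × f⟨ g , h′ ⟩ ≡ 2) ⊎ (∃ λ g′ → Adj G g g′ × f⟨ g′ , h ⟩ ≡ 2)

  zero-covered-in-fibres : ∀ g h → f⟨ g , h ⟩ ≡ 0 → CoveredInFibres g h
  zero-covered-in-fibres g h f≡0 with f-rdf (combine g h) f≡0
  ... | y , adj , f≡2 = inCoordinates (combine-remQuot {n G} (n H) y) adj f≡2
    where
    inCoordinates : ∀ {g′ : Fin (n G)} {h′ : Fin (n H)} {y} → combine g′ h′ ≡ y →
      □-Adj G H (combine g h) y → toℕ (f y) ≡ 2 → CoveredInFibres g h
    inCoordinates {g′} {h′} refl adj f≡2 with □-Adj-combine G H adj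
    ... | inj₁ (refl , adjH) = inj₁ (h′ , adjH , f≡2)
    ... | inj₂ (adjG , refl) = inj₂ (g′ , adjG , f≡2)

  -- `vertex` is c(u,h); `dominates` and `covered` are exactly what makes `project u` Roman dominating.
  record Shadow (u : Fin (n G)) (h : Fin (n H)) : Set where
    field
      vertex    : Fin (n G)
      near      : InClosedNbhd G u vertex
      dominates : f⟨ u , h ⟩ ≤ f⟨ vertex , h ⟩
      covered   : f⟨ vertex , h ⟩ ≡ 0 → ∃ λ h′ → Adj H h h′ × f⟨ u , h′ ⟩ ≡ 2

  shadow : ∀ u h → Shadow u h
  shadow u h with f⟨ u , h ⟩ ≟ 0
  ... | no f≢0 = record
    { vertex = u ; near = inj₁ refl ; dominates = ≤-refl ; covered = λ f≡0 → contradiction f≡0 f≢0 }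
  ... | yes f≡0 with zero-covered-in-fibres u h f≡0
  ...   | inj₁ coveredInH = record
    { vertex = u ; near = inj₁ refl ; dominates = ≤-refl ; covered = λ _ → coveredInH }
  ...   | inj₂ (g , adj , f≡2) = record
    { vertex = g ; near = inj₂ adj ; dominates = subst (_≤ f⟨ g , h ⟩) (sym f≡0) z≤n
    ; covered = λ f≡0′ → contradiction (trans (sym f≡0′) f≡2) λ () }

  open Shadow

  project : Fin (n G) → Fin (n H) → Fin 3
  project u h = f (combine (vertex (shadow u h)) h)

  project-isRDF : ∀ u → IsRDF H (project u)
  project-isRDF u h proj≡0 with covered (shadow u h) proj≡0
  ... | h′ , adj , f≡2 = h′ , adj , ≤-antisym (s≤s⁻¹ (toℕ<n (project u h′)))
                                    (subst (_≤ toℕ (project u h′)) f≡2 (dominates (shadow u h′)))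

  shadow-injective : ∀ {S} → Is2Packing G S → ∀ {u v} h → u ∈ S → v ∈ S →
    vertex (shadow u h) ≡ vertex (shadow v h) → u ≡ v
  shadow-injective packing {u} {v} h u∈S v∈S same with u ≟ᶠ v
  ... | yes u≡v = u≡v
  ... | no u≢v = contradiction (near (shadow v h))
        (packing u v u∈S v∈S u≢v (vertex (shadow v h)) (subst (InClosedNbhd G u) same (near (shadow u h))))

  projectedLayer : Fin (n H) → Vector ℕ (n G)
  projectedLayer h u = toℕ (project u h)

  projectedValue : Subset (n G) → Fin (n G) → Fin (n H) → ℕ
  projectedValue S u h = restrict S (projectedLayer h) u

  fibre-bound : ∀ {S} → Is2Packing G S → ∀ h →
    ∑[ u < n G ] projectedValue S u h ≤ ∑[ g < n G ] f⟨ g , h ⟩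
  fibre-bound {S} packing h =
    ∑-≤-injectiveOnSupport (λ u → projectedValue S u h) (λ g → f⟨ g , h ⟩) (λ u → vertex (shadow u h))
      (restrict-≤ S _) injective
    where
    injective : ∀ u v → 0 < projectedValue S u h → 0 < projectedValue S v h →
      vertex (shadow u h) ≡ vertex (shadow v h) → u ≡ v
    injective u v p q = shadow-injective packing h
      (restrict-support S (projectedLayer h) u p) (restrict-support S (projectedLayer h) v q)

  projection-bound : ∀ {S r} → (∀ φ → IsRDF H φ → r ≤ weight H φ) → ∀ u →
    restrict S (const r) u ≤ ∑[ h < n H ] projectedValue S u h
  projection-bound {S} {r} γR≤ u with lookup S u
  ... | true  = subst (r ≤_) (weight≡∑ H (project u)) (γR≤ (project u) (project-isRDF u))
  ... | false = z≤n

  packing-bound : ∀ {S r} → Is2Packing G S → (∀ φ → IsRDF H φ → r ≤ weight H φ) →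
    ∣ S ∣ * r ≤ weight (G □ H) f
  packing-bound {S} {r} packing γR≤ = begin
    ∣ S ∣ * r                                          ≡⟨ ∑-restrict-const S r ⟨
    ∑[ u < n G ] restrict S (const r) u                ≤⟨ ∑-mono-≤ (projection-bound {S} γR≤) ⟩
    ∑[ u < n G ] ∑[ h < n H ] projectedValue S u h     ≡⟨ ∑-comm (projectedValue S) ⟩
    ∑[ h < n H ] ∑[ u < n G ] projectedValue S u h     ≤⟨ ∑-mono-≤ (fibre-bound packing) ⟩
    ∑[ h < n H ] ∑[ g < n G ] f⟨ g , h ⟩                ≡⟨ ∑-comm f⟨_,_⟩ ⟨
    ∑[ g < n G ] ∑[ h < n H ] f⟨ g , h ⟩                ≡⟨ ∑-combine +-0-monoid (n G) (n H) (toℕ ∘ f) ⟨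
    ∑[ x < n G * n H ] toℕ (f x)                       ≡⟨ weight≡∑ (G □ H) f ⟨
    weight (G □ H) f                                   ∎
    where open ≤-Reasoning

corollary9 : (G H : Graph) → InClassF G → IsRomanGraph H →
    ∀ γG γH γR → IsDominationNumber G γG → IsDominationNumber H γH →
    IsRomanDominationNumber (G □ H) γR → 2 * γG * γH ≤ γR
corollary9 G H (S , S-dominating , _ , packing) romanH γG γH γR (_ , γG-minimum) γH-value
           ((f , f-rdf , weight≡γR) , _) = begin
  2 * γG * γH      ≡⟨ cong (_* γH) (*-comm 2 γG) ⟩
  γG * 2 * γH      ≡⟨ *-assoc γG 2 γH ⟩
  γG * (2 * γH)    ≤⟨ *-monoˡ-≤ (2 * γH) (γG-minimum S S-dominating) ⟩
  ∣ S ∣ * (2 * γH) ≤⟨ Projection.packing-bound G H f f-rdf packing (proj₂ (romanH γH γH-value)) ⟩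
  weight (G □ H) f ≡⟨ weight≡γR ⟩
  γR               ∎
  where open ≤-Reasoning
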